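{- Each of the eight cirquent calculus rules (the empty cirquent axiom and identity axiom, mix, exchange, weakening, duplication, contraction, $\vee$-introduction and $\wedge$-introduction) preserves truth in the top-down direction: whenever the premise(s) of an application of any given rule is (are) true in a given classical model, so is the conclusion. In particular, the conclusions of the axioms (which take no premises) are tautologies.
   Context: Formulas are built from infinitely many propositional atoms using $\neg$ (applied only to atoms; $\neg\neg F$ abbreviates $F$, and $\neg$ of a compound formula is understood via De Morgan's laws), $\wedge$ and $\vee$. A $k$-ary cirquent is a pair consisting of a pool, i.e. a sequence $\langle F_1,\ldots,F_k\rangle$ of formulas (their occurrences are called oformulas), and a structure, i.e. a finite sequence of groups, each group being a subset of $\{1,\ldots,k\}$, thought of as the set of oformulas it contains (occurrences of groups are called ogroups). A formula $F$ is identified with the cirquent with pool $\langle F\rangle$ and structure $\langle\{1\}\rangle$. A classical model assigns a truth value to each atom and extends to formulas in the standard way. A group of a cirquent is true in a model iff at least one of its oformulas is true; a cirquent is true in a model iff all of its groups are true; a cirquent is a tautology iff it is true in every model. The rules are: (Axioms) the empty cirquent (empty pool and empty structure), and the identity axiom: pool $\langle\neg F,F\rangle$, structure $\langle\{1,2\}\rangle$. (Mix) from two premises, the conclusion places one next to the other (concatenating pools and structures). (Exchange) swap two adjacent oformulas, correspondingly redirecting group membership, or swap two adjacent ogroups. (Weakening) add an existing oformula to an existing ogroup, or insert a new oformula anywhere in the pool (belonging to no group). (Duplication) downward: replace an ogroup by two adjacent ogroups identical to it as groups; upward: the converse. (Contraction) merge two adjacent oformulas that are the same formula $F$ into one oformula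 $F$, every ogroup that contained either of them now containing the merged one. ($\vee$-introduction) merge two adjacent oformulas $F,G$ into one oformula $F\vee G$, so that an ogroup of the conclusion contains $F\vee G$ iff the corresponding ogroup of the premise contains at least one of $F,G$. ($\wedge$-introduction) the premise has adjacent oformulas $F,G$ such that no ogroup contains both, every ogroup containing $F$ is immediately followed by an ogroup containing $G$, and every ogroup containing $G$ is immediately preceded by an ogroup containing $F$; the conclusion merges each ogroup containing $F$ with the immediately following ogroup (taking the union), and then merges $F$ and $G$ into the single oformula $F\wedge G$. -}

module Defs where

open import Data.Nat using (ℕ; zero; suc; _+_)
open import Data.Bool using (Bool; true; false; not; if_then_else_; _∨_; _∧_; T)
open import Data.Fin using (Fin; toℕ)
open import Data.Vec using (Vec; []; _∷_; _++_; lookup; replicate; _[_]≔_; zipWith)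
open import Data.List using (List; []; _∷_; map; length)
import Data.List as L
open import Data.List.Relation.Unary.All using (All)
open import Data.Product using (Σ; _×_; _,_)
open import Relation.Binary.PropositionalEquality using (_≡_)
open import Relation.Nullary using (¬_)

data Formula : Set where
  atom  : ℕ → Formula
  natom : ℕ → Formula
  _∧ᶠ_  : Formula → Formula → Formula
  _∨ᶠ_  : Formula → Formula → Formula

negᶠ : Formula → Formula
negᶠ (atom n)  = natom n
negᶠ (natom n) = atom n
negᶠ (A ∧ᶠ B)  = negᶠ A ∨ᶠ negᶠ B
negᶠ (A ∨ᶠ B)  = negᶠ A ∧ᶠ negᶠ B

-- Cirquents: a pool of k oformulas and a structure, i.e. a finite
-- sequence (list) of groups; a group is a subset of the k positions,
-- given by its characteristic vector.

Group : ℕ → Set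
Group k = Vec Bool k

record Cirquent : Set where
  constructor cq
  field
    k      : ℕ
    pool   : Vec Formula k
    struct : List (Group k)

Model : Set
Model = ℕ → Bool

eval : Model → Formula → Bool
eval M (atom n)  = M n
eval M (natom n) = not (M n)
eval M (A ∧ᶠ B)  = eval M A ∧ eval M B
eval M (A ∨ᶠ B)  = eval M A ∨ eval M B

GroupTrue : Model → {k : ℕ} → Vec Formula k → Group k → Set
GroupTrue M {k} pool g = Σ (Fin k) λ i → T (lookup g i) × T (eval M (lookup pool i))

CTrue : Model → Cirquent → Set
CTrue M (cq k pool struct) = All (GroupTrue M pool) struct

Tautology : Cirquent → Set
Tautology C = (M : Model) → CTrue M C

combineAt : ∀ {A : Set} m {n} → (A → A → A) → Vec A (m + suc (suc n)) → Vec A (m + suc n)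
combineAt zero    f (x ∷ y ∷ v) = f x y ∷ v
combineAt (suc m) f (x ∷ v)     = x ∷ combineAt m f v

swapAt : ∀ {A : Set} m {n} → Vec A (m + suc (suc n)) → Vec A (m + suc (suc n))
swapAt zero    (x ∷ y ∷ v) = y ∷ x ∷ v
swapAt (suc m) (x ∷ v)     = x ∷ swapAt m v

insertAt : ∀ {A : Set} m {n} → A → Vec A (m + n) → Vec A (m + suc n)
insertAt zero    a v       = a ∷ v
insertAt (suc m) a (x ∷ v) = x ∷ insertAt m a v

adjAt : ∀ {A : Set} m {n} → Vec A (m + suc (suc n)) → A × A
adjAt zero    (x ∷ y ∷ v) = x , y
adjAt (suc m) (x ∷ v)     = adjAt m v

hasFst : ∀ m {n} → Group (m + suc (suc n)) → Bool
hasFst m g = Data.Product.proj₁ (adjAt m g)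

hasSnd : ∀ m {n} → Group (m + suc (suc n)) → Bool
hasSnd m g = Data.Product.proj₂ (adjAt m g)

_∪ᵍ_ : ∀ {k} → Group k → Group k → Group k
_∪ᵍ_ = zipWith _∨_

andMerge : ∀ m {n} → List (Group (m + suc (suc n))) → List (Group (m + suc (suc n)))
andMerge m []            = []
andMerge m (g ∷ [])      = g ∷ []
andMerge m (g ∷ h ∷ S) =
  if hasFst m g then (g ∪ᵍ h) ∷ andMerge m S else g ∷ andMerge m (h ∷ S)

data Rule : List Cirquent → Cirquent → Set where
  empty-ax : Rule [] (cq 0 [] [])
  id-ax    : (F : Formula) →
             Rule [] (cq 2 (negᶠ F ∷ F ∷ []) ((true ∷ true ∷ []) ∷ []))
  mix : ∀ k₁ k₂ (p₁ : Vec Formula k₁) (p₂ : Vec Formula k₂)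
          (S₁ : List (Group k₁)) (S₂ : List (Group k₂)) →
        Rule (cq k₁ p₁ S₁ ∷ cq k₂ p₂ S₂ ∷ [])
             (cq (k₁ + k₂) (p₁ ++ p₂)
                 (L._++_ (map (λ g → g ++ replicate k₂ false) S₁)
                         (map (λ g → replicate k₁ false ++ g) S₂)))
  exch-formula : ∀ m n (as : Vec Formula m) (F G : Formula) (bs : Vec Formula n)
                   (S : List (Group (m + suc (suc n)))) →
                 Rule (cq (m + suc (suc n)) (as ++ F ∷ G ∷ bs) S ∷ [])
                      (cq (m + suc (suc n)) (as ++ G ∷ F ∷ bs) (map (swapAt m) S))
  exch-group : ∀ k (p : Vec Formula k) (S₁ S₂ : List (Group k)) (g h : Group k) →
               Rule (cq k p (L._++_ S₁ (g ∷ h ∷ S₂)) ∷ [])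
                    (cq k p (L._++_ S₁ (h ∷ g ∷ S₂)))
  weak-add : ∀ k (p : Vec Formula k) (S₁ S₂ : List (Group k)) (g : Group k) (i : Fin k) →
             Rule (cq k p (L._++_ S₁ (g ∷ S₂)) ∷ [])
                  (cq k p (L._++_ S₁ ((g [ i ]≔ true) ∷ S₂)))
  weak-insert : ∀ m n (as : Vec Formula m) (F : Formula) (bs : Vec Formula n)
                  (S : List (Group (m + n))) →
                Rule (cq (m + n) (as ++ bs) S ∷ [])
                     (cq (m + suc n) (as ++ F ∷ bs) (map (insertAt m false) S))
  dup-down : ∀ k (p : Vec Formula k) (S₁ S₂ : List (Group k)) (g : Group k) →
             Rule (cq k p (L._++_ S₁ (g ∷ S₂)) ∷ [])
                  (cq k p (L._++_ S₁ (g ∷ g ∷ S₂)))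
  dup-up   : ∀ k (p : Vec Formula k) (S₁ S₂ : List (Group k)) (g : Group k) →
             Rule (cq k p (L._++_ S₁ (g ∷ g ∷ S₂)) ∷ [])
                  (cq k p (L._++_ S₁ (g ∷ S₂)))
  contr : ∀ m n (as : Vec Formula m) (F : Formula) (bs : Vec Formula n)
            (S : List (Group (m + suc (suc n)))) →
          Rule (cq (m + suc (suc n)) (as ++ F ∷ F ∷ bs) S ∷ [])
               (cq (m + suc n) (as ++ F ∷ bs) (map (combineAt m _∨_) S))
  or-intro : ∀ m n (as : Vec Formula m) (F G : Formula) (bs : Vec Formula n)
               (S : List (Group (m + suc (suc n)))) →
             Rule (cq (m + suc (suc n)) (as ++ F ∷ G ∷ bs) S ∷ [])
                  (cq (m + suc n) (as ++ (F ∨ᶠ G) ∷ bs) (map (combineAt m _∨_) S))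
  and-intro : ∀ m n (as : Vec Formula m) (F G : Formula) (bs : Vec Formula n)
                (S : List (Group (m + suc (suc n)))) →
              ((i : Fin (length S)) →
                 ¬ (T (hasFst m (L.lookup S i)) × T (hasSnd m (L.lookup S i)))) →
              ((i : Fin (length S)) → T (hasFst m (L.lookup S i)) →
                 Σ (Fin (length S)) λ j → (toℕ j ≡ suc (toℕ i)) × T (hasSnd m (L.lookup S j))) →
              ((j : Fin (length S)) → T (hasSnd m (L.lookup S j)) →
                 Σ (Fin (length S)) λ i → (toℕ j ≡ suc (toℕ i)) × T (hasFst m (L.lookup S i))) →
              Rule (cq (m + suc (suc n)) (as ++ F ∷ G ∷ bs) S ∷ [])
                   (cq (m + suc n) (as ++ (F ∧ᶠ G) ∷ bs)
                       (map (combineAt m _∨_) (andMerge m S)))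

{-# OPTIONS --safe #-}
-- The truth value of a group g over a pool p is ⋁ᵢ (gᵢ ∧ ⟦pᵢ⟧). Every rule other than
-- ∧-introduction acts on the groups one at a time (or merely copies, drops or permutes
-- them), by a map that cannot lower this value. For ∧-introduction the three side
-- conditions force the groups touching F or G into adjacent pairs (F-group, G-group),
-- and only such pairs get merged.
module Submission where

open import Defs
open import Data.List using (List; [])
open import Data.List.Relation.Unary.All using (All)
open import Data.Product using (_×_)

open import Algebra.Bundles using (CommutativeMonoid)
open import Data.Bool using (Bool; true; false; not; _∧_; _∨_; T)
open import Data.Bool.Properties
  using (∨-assoc; ∨-identityʳ; ∨-inverseˡ; ∧-distribʳ-∨; not-involutive; T?; T-∧; T-∨;
         ∨-commutativeMonoid; ∨-∧-booleanAlgebra)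
open import Algebra.Properties.CommutativeSemigroup
  (CommutativeMonoid.commutativeSemigroup ∨-commutativeMonoid)
  using () renaming (interchange to ∨-interchange; x∙yz≈y∙xz to ∨-swapˡ)
open import Algebra.Lattice.Properties.BooleanAlgebra ∨-∧-booleanAlgebra
  using (deMorgan₁; deMorgan₂)
open import Data.Empty using (⊥-elim)
open import Data.Fin using (Fin; zero; suc; toℕ)
open import Data.List using (_∷_; length; lookup)
import Data.List as List
open import Data.List.Relation.Unary.All using ([]; _∷_)
import Data.List.Relation.Unary.All as All
import Data.List.Relation.Unary.All.Properties as All
open import Data.Nat using (zero; suc; _+_)
open import Data.Nat.Properties using (suc-injective)
open import Data.Product using (Σ; _,_)
import Data.Product as Product
open import Data.Sum using (inj₁; inj₂)
import Data.Sum as Sum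
open import Data.Vec using (Vec; []; _∷_; _++_; replicate; _[_]≔_)
open import Function using (_∘_; id)
open import Function.Bundles using (module Equivalence)
open import Level using (_⊔_)
open import Relation.Binary.PropositionalEquality
  using (_≡_; refl; sym; trans; cong; cong₂; subst; module ≡-Reasoning)
open import Relation.Nullary using (¬_; yes; no)
open import Relation.Unary using (Pred; Decidable)

open Equivalence using (to; from)

mapSuffix : ∀ {a p} {A : Set a} {P : Pred A p} xs {ys zs : List A} →
            (All P ys → All P zs) → All P (xs List.++ ys) → All P (xs List.++ zs)
mapSuffix xs f t = All.++⁺ (All.++⁻ˡ xs t) (f (All.++⁻ʳ xs t))

module _ {a p q} {A : Set a} (P : Pred A p) (Q : Pred A q) where

  Exclusive : List A → Set (p ⊔ q)
  Exclusive xs = (i : Fin (length xs)) → ¬ (P (lookup xs i) × Q (lookup xs i))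

  FollowedBy : List A → Set (p ⊔ q)
  FollowedBy xs = (i : Fin (length xs)) → P (lookup xs i) →
                  Σ (Fin (length xs)) λ j → toℕ j ≡ suc (toℕ i) × Q (lookup xs j)

  PrecededBy : List A → Set (p ⊔ q)
  PrecededBy xs = (j : Fin (length xs)) → Q (lookup xs j) →
                  Σ (Fin (length xs)) λ i → toℕ j ≡ suc (toℕ i) × P (lookup xs i)

  data Paired : List A → Set (a ⊔ p ⊔ q) where
    []   : Paired []
    skip : ∀ {x xs} → ¬ P x → ¬ Q x → Paired xs → Paired (x ∷ xs)
    pair : ∀ {x y xs} → P x → ¬ Q x → ¬ P y → Q y → Paired xs → Paired (x ∷ y ∷ xs)

  followedBy-tail : ∀ {x xs} → FollowedBy (x ∷ xs) → FollowedBy xs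
  followedBy-tail fol i pi with fol (suc i) pi
  ... | zero  , () , _
  ... | suc j , eq , qj = j , suc-injective eq , qj

  precededBy-tail : ∀ {x xs} → ¬ P x → PrecededBy (x ∷ xs) → PrecededBy xs
  precededBy-tail ¬px pre j qj with pre (suc j) qj
  ... | zero  , _  , px = ⊥-elim (¬px px)
  ... | suc i , eq , pi = i , suc-injective eq , pi

  precededBy-tail₂ : ∀ {x y xs} → ¬ P y → PrecededBy (x ∷ y ∷ xs) → PrecededBy xs
  precededBy-tail₂ ¬py pre j qj with pre (suc (suc j)) qj
  ... | zero        , () , _
  ... | suc zero    , _  , py = ⊥-elim (¬py py)
  ... | suc (suc i) , eq , pi = i , suc-injective (suc-injective eq) , pi

  paired : Decidable P → ∀ xs → Exclusive xs → FollowedBy xs → PrecededBy xs → Paired xs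
  paired P? [] _ _ _ = []
  paired P? (x ∷ xs) ex fol pre with P? x
  paired P? (x ∷ xs) ex fol pre | no ¬px =
    skip ¬px ¬qx
         (paired P? xs (λ i → ex (suc i)) (followedBy-tail fol) (precededBy-tail ¬px pre))
    where
    ¬qx : ¬ Q x
    ¬qx qx with pre zero qx
    ... | _ , () , _
  paired P? (x ∷ []) ex fol pre | yes px with fol zero px
  ... | zero , () , _
  paired P? (x ∷ y ∷ xs) ex fol pre | yes px with fol zero px
  ... | zero        , () , _
  ... | suc (suc _) , () , _
  ... | suc zero    , _  , qy =
    pair px (λ qx → ex zero (px , qx)) ¬py qy
         (paired P? xs (λ i → ex (suc (suc i)))
                 (followedBy-tail (followedBy-tail fol)) (precededBy-tail₂ ¬py pre))
    where
    ¬py : ¬ P y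
    ¬py py = ex (suc zero) (py , qy)

∨-monoʳ : ∀ a {b b′} → (T b → T b′) → T (a ∨ b) → T (a ∨ b′)
∨-monoʳ true  _ = id
∨-monoʳ false f = f

-- x, y: membership of a group in two adjacent oformulas of values a, b;
-- c: value of the single oformula that replaces them.
Merges : (x y a b c : Bool) → Set
Merges x y a b c = T ((x ∧ a) ∨ (y ∧ b)) → T ((x ∨ y) ∧ c)

merges-contraction : ∀ x y a → Merges x y a a a
merges-contraction x y a = subst T (sym (∧-distribʳ-∨ a x y))

merges-∨ : ∀ x y a b → Merges x y a b (a ∨ b)
merges-∨ true  _     true  _     _ = _
merges-∨ true  true  false true  _ = _
merges-∨ false true  true  true  _ = _
merges-∨ false true  false true  _ = _
merges-∨ true  true  false false ()
merges-∨ true  false false _     ()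
merges-∨ false true  _     false ()
merges-∨ false false _     _     ()

merges-∧ : ∀ x y a b → ¬ T y → T b → Merges x y a b (a ∧ b)
merges-∧ _     true  _     _     ¬y _  _  = ⊥-elim (¬y _)
merges-∧ true  false true  true  _  _  _  = _
merges-∧ true  false true  false _  () _
merges-∧ true  false false _     _  _  ()
merges-∧ false false _     _     _  _  ()

merges-absent : ∀ x y a b c → ¬ T x → ¬ T y → Merges x y a b c
merges-absent true  _     _ _ _ ¬x _  _  = ⊥-elim (¬x _)
merges-absent false true  _ _ _ _  ¬y _  = ⊥-elim (¬y _)
merges-absent false false _ _ _ _  _  ()

merges-absent-false : ∀ x y a b c → ¬ T x → ¬ T b → Merges x y a b c
merges-absent-false true  _     _ _     _ ¬x _  _  = ⊥-elim (¬x _)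
merges-absent-false false _     _ true  _ _  ¬b _  = ⊥-elim (¬b _)
merges-absent-false false true  _ false _ _  _  ()
merges-absent-false false false _ false _ _  _  ()

eval-negᶠ : ∀ M F → eval M (negᶠ F) ≡ not (eval M F)
eval-negᶠ M (atom n)  = refl
eval-negᶠ M (natom n) = sym (not-involutive (M n))
eval-negᶠ M (A ∧ᶠ B)  =
  trans (cong₂ _∨_ (eval-negᶠ M A) (eval-negᶠ M B)) (sym (deMorgan₁ (eval M A) (eval M B)))
eval-negᶠ M (A ∨ᶠ B)  =
  trans (cong₂ _∧_ (eval-negᶠ M A) (eval-negᶠ M B)) (sym (deMorgan₂ (eval M A) (eval M B)))

combineAt-∪ : ∀ m {n} (g h : Group (m + suc (suc n))) →
              combineAt m _∨_ (g ∪ᵍ h) ≡ combineAt m _∨_ g ∪ᵍ combineAt m _∨_ h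
combineAt-∪ zero    (x ∷ y ∷ g) (x′ ∷ y′ ∷ h) = cong (_∷ (g ∪ᵍ h)) (∨-interchange x x′ y y′)
combineAt-∪ (suc m) (x ∷ g)     (x′ ∷ h)      = cong ((x ∨ x′) ∷_) (combineAt-∪ m g h)

andMerge-skip : ∀ m {n} {g} {S : List (Group (m + suc (suc n)))} →
                ¬ T (hasFst m g) → andMerge m (g ∷ S) ≡ g ∷ andMerge m S
andMerge-skip m         {S = []}    _ = refl
andMerge-skip m {g = g} {S = _ ∷ _} ¬f with hasFst m g
... | true  = ⊥-elim (¬f _)
... | false = refl

andMerge-pair : ∀ m {n} {g h} {S : List (Group (m + suc (suc n)))} →
                T (hasFst m g) → andMerge m (g ∷ h ∷ S) ≡ (g ∪ᵍ h) ∷ andMerge m S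
andMerge-pair m {g = g} f with hasFst m g
... | true = refl

module _ (M : Model) where

  groupValue : ∀ {k} → Vec Formula k → Group k → Bool
  groupValue []      []      = false
  groupValue (F ∷ p) (b ∷ g) = (b ∧ eval M F) ∨ groupValue p g

  groupValue-complete : ∀ {k} (p : Vec Formula k) g → GroupTrue M p g → T (groupValue p g)
  groupValue-complete (_ ∷ p) (_ ∷ g) (zero  , w) = from T-∨ (inj₁ (from T-∧ w))
  groupValue-complete (_ ∷ p) (_ ∷ g) (suc i , w) =
    from T-∨ (inj₂ (groupValue-complete p g (i , w)))

  groupValue-sound : ∀ {k} (p : Vec Formula k) g → T (groupValue p g) → GroupTrue M p g
  groupValue-sound []      []      ()
  groupValue-sound (_ ∷ p) (_ ∷ g) t with to T-∨ t
  ... | inj₁ here  = zero , to T-∧ here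
  ... | inj₂ there = Product.map suc id (groupValue-sound p g there)

  GroupTrue-map⁺ : ∀ {k k′} (p : Vec Formula k) (q : Vec Formula k′)
                   (f : Group k → Group k′) {S} →
                   (∀ g → T (groupValue p g) → T (groupValue q (f g))) →
                   All (GroupTrue M p) S → All (GroupTrue M q) (List.map f S)
  GroupTrue-map⁺ p q f preserves =
    All.map⁺ ∘ All.map (λ {g} → groupValue-sound q (f g) ∘ preserves g ∘ groupValue-complete p g)

  groupValue-++ : ∀ {k l} (p : Vec Formula k) (q : Vec Formula l) g h →
                  groupValue (p ++ q) (g ++ h) ≡ groupValue p g ∨ groupValue q h
  groupValue-++ []      q []      h = refl
  groupValue-++ (F ∷ p) q (b ∷ g) h =
    trans (cong ((b ∧ eval M F) ∨_) (groupValue-++ p q g h))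
          (sym (∨-assoc (b ∧ eval M F) (groupValue p g) (groupValue q h)))

  groupValue-∅ : ∀ {k} (p : Vec Formula k) → groupValue p (replicate k false) ≡ false
  groupValue-∅ []      = refl
  groupValue-∅ (_ ∷ p) = groupValue-∅ p

  groupValue-padʳ : ∀ {k l} (p : Vec Formula k) (q : Vec Formula l) g →
                    groupValue (p ++ q) (g ++ replicate l false) ≡ groupValue p g
  groupValue-padʳ p q g = begin
    groupValue (p ++ q) (g ++ replicate _ false)      ≡⟨ groupValue-++ p q g _ ⟩
    groupValue p g ∨ groupValue q (replicate _ false) ≡⟨ cong (groupValue p g ∨_) (groupValue-∅ q) ⟩
    groupValue p g ∨ false                            ≡⟨ ∨-identityʳ _ ⟩
    groupValue p g                                    ∎
    where open ≡-Reasoning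

  groupValue-padˡ : ∀ {k l} (p : Vec Formula k) (q : Vec Formula l) h →
                    groupValue (p ++ q) (replicate k false ++ h) ≡ groupValue q h
  groupValue-padˡ p q h = trans (groupValue-++ p q _ h) (cong (_∨ groupValue q h) (groupValue-∅ p))

  groupValue-∪ : ∀ {k} (p : Vec Formula k) g h →
                 groupValue p (g ∪ᵍ h) ≡ groupValue p g ∨ groupValue p h
  groupValue-∪ []      []      []      = refl
  groupValue-∪ (F ∷ p) (b ∷ g) (c ∷ h) = begin
    ((b ∨ c) ∧ f) ∨ groupValue p (g ∪ᵍ h)
      ≡⟨ cong₂ _∨_ (∧-distribʳ-∨ f b c) (groupValue-∪ p g h) ⟩
    ((b ∧ f) ∨ (c ∧ f)) ∨ (groupValue p g ∨ groupValue p h)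
      ≡⟨ ∨-interchange (b ∧ f) (c ∧ f) (groupValue p g) (groupValue p h) ⟩
    ((b ∧ f) ∨ groupValue p g) ∨ ((c ∧ f) ∨ groupValue p h) ∎
    where
    open ≡-Reasoning
    f = eval M F

  groupValue-[]≔true : ∀ {k} (p : Vec Formula k) g i →
                       T (groupValue p g) → T (groupValue p (g [ i ]≔ true))
  groupValue-[]≔true (F ∷ p) (true  ∷ g) zero    = id
  groupValue-[]≔true (F ∷ p) (false ∷ g) zero    = from T-∨ ∘ inj₂
  groupValue-[]≔true (F ∷ p) (b     ∷ g) (suc i) =
    ∨-monoʳ (b ∧ eval M F) (groupValue-[]≔true p g i)

  groupValue-swapAt : ∀ {m n} (as : Vec Formula m) F G (bs : Vec Formula n) g →
                      groupValue (as ++ G ∷ F ∷ bs) (swapAt m g) ≡ groupValue (as ++ F ∷ G ∷ bs) g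
  groupValue-swapAt []       F G bs (x ∷ y ∷ g) =
    ∨-swapˡ (y ∧ eval M G) (x ∧ eval M F) (groupValue bs g)
  groupValue-swapAt (A ∷ as) F G bs (x ∷ g)     =
    cong ((x ∧ eval M A) ∨_) (groupValue-swapAt as F G bs g)

  groupValue-insertAt : ∀ {m n} (as : Vec Formula m) F (bs : Vec Formula n) g →
                        groupValue (as ++ F ∷ bs) (insertAt m false g) ≡ groupValue (as ++ bs) g
  groupValue-insertAt []       F bs g       = refl
  groupValue-insertAt (A ∷ as) F bs (x ∷ g) =
    cong ((x ∧ eval M A) ∨_) (groupValue-insertAt as F bs g)

  groupValue-combineAt : ∀ {m n} (as : Vec Formula m) (bs : Vec Formula n) F G H g →
                         Merges (hasFst m g) (hasSnd m g) (eval M F) (eval M G) (eval M H) →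
                         T (groupValue (as ++ F ∷ G ∷ bs) g) →
                         T (groupValue (as ++ H ∷ bs) (combineAt m _∨_ g))
  groupValue-combineAt []       bs F G H (x ∷ y ∷ g) merges =
    from T-∨ ∘ Sum.map merges id ∘ to T-∨ ∘
    subst T (sym (∨-assoc (x ∧ eval M F) (y ∧ eval M G) (groupValue bs g)))
  groupValue-combineAt (A ∷ as) bs F G H (x ∷ g)     merges =
    ∨-monoʳ (x ∧ eval M A) (groupValue-combineAt as bs F G H g merges)

  -- If G holds, F alone already forces F ∧ G, so the truth of g survives the merge;
  -- otherwise the truth of h cannot come from G, and it survives instead.
  groupValue-andPair : ∀ {m n} (as : Vec Formula m) F G (bs : Vec Formula n) g h →
                       ¬ T (hasSnd m g) → ¬ T (hasFst m h) →
                       T (groupValue (as ++ F ∷ G ∷ bs) g) → T (groupValue (as ++ F ∷ G ∷ bs) h) →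
                       T (groupValue (as ++ (F ∧ᶠ G) ∷ bs) (combineAt m _∨_ (g ∪ᵍ h)))
  groupValue-andPair {m} as F G bs g h ¬Gg ¬Fh tg th
    rewrite combineAt-∪ m g h
          | groupValue-∪ (as ++ (F ∧ᶠ G) ∷ bs) (combineAt m _∨_ g) (combineAt m _∨_ h)
    with T? (eval M G)
  ... | yes tG = from T-∨ (inj₁ (groupValue-combineAt as bs F G (F ∧ᶠ G) g
                   (merges-∧ (hasFst m g) (hasSnd m g) (eval M F) (eval M G) ¬Gg tG) tg))
  ... | no ¬G  = from T-∨ (inj₂ (groupValue-combineAt as bs F G (F ∧ᶠ G) h
                   (merges-absent-false (hasFst m h) (hasSnd m h) (eval M F) (eval M G) _
                      ¬Fh ¬G) th))

  groupValue-andMerge : ∀ {m n} (as : Vec Formula m) F G (bs : Vec Formula n) {S} →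
                        Paired (T ∘ hasFst m {n}) (T ∘ hasSnd m) S →
                        All (T ∘ groupValue (as ++ F ∷ G ∷ bs)) S →
                        All (T ∘ groupValue (as ++ (F ∧ᶠ G) ∷ bs) ∘ combineAt m _∨_) (andMerge m S)
  groupValue-andMerge as F G bs [] [] = []
  groupValue-andMerge {m} as F G bs (skip {g} {S} ¬Fg ¬Gg ps) (tg ∷ t)
    rewrite andMerge-skip m {S = S} ¬Fg =
    groupValue-combineAt as bs F G (F ∧ᶠ G) g
      (merges-absent (hasFst m g) (hasSnd m g) (eval M F) (eval M G) _ ¬Fg ¬Gg) tg
    ∷ groupValue-andMerge as F G bs ps t
  groupValue-andMerge {m} as F G bs (pair {g} {h} {S} Fg ¬Gg ¬Fh _ ps) (tg ∷ th ∷ t)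
    rewrite andMerge-pair m {h = h} {S = S} Fg =
    groupValue-andPair as F G bs g h ¬Gg ¬Fh tg th ∷ groupValue-andMerge as F G bs ps t

  groupValue-identity : ∀ F → groupValue (negᶠ F ∷ F ∷ []) (true ∷ true ∷ []) ≡ true
  groupValue-identity F = begin
    eval M (negᶠ F) ∨ (eval M F ∨ false) ≡⟨ cong₂ _∨_ (eval-negᶠ M F) (∨-identityʳ (eval M F)) ⟩
    not (eval M F) ∨ eval M F            ≡⟨ ∨-inverseˡ (eval M F) ⟩
    true                                 ∎
    where open ≡-Reasoning

sound : ∀ {ps C} → Rule ps C → (M : Model) → All (CTrue M) ps → CTrue M C
sound empty-ax M [] = []
sound (id-ax F) M [] =
  groupValue-sound M _ _ (subst T (sym (groupValue-identity M F)) _) ∷ []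
sound (mix k₁ k₂ p₁ p₂ S₁ S₂) M (t₁ ∷ t₂ ∷ []) =
  All.++⁺ (GroupTrue-map⁺ M p₁ (p₁ ++ p₂) (_++ replicate k₂ false)
             (λ g → subst T (sym (groupValue-padʳ M p₁ p₂ g))) t₁)
          (GroupTrue-map⁺ M p₂ (p₁ ++ p₂) (replicate k₁ false ++_)
             (λ h → subst T (sym (groupValue-padˡ M p₁ p₂ h))) t₂)
sound (exch-formula m n as F G bs S) M (t ∷ []) =
  GroupTrue-map⁺ M (as ++ F ∷ G ∷ bs) (as ++ G ∷ F ∷ bs) (swapAt m)
    (λ g → subst T (sym (groupValue-swapAt M as F G bs g))) t
sound (exch-group k p S₁ S₂ g h) M (t ∷ []) =
  mapSuffix S₁ (λ { (tg ∷ th ∷ t′) → th ∷ tg ∷ t′ }) t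
sound (weak-add k p S₁ S₂ g i) M (t ∷ []) =
  mapSuffix S₁ (λ { (tg ∷ t′) → weaken tg ∷ t′ }) t
  where
  weaken : GroupTrue M p g → GroupTrue M p (g [ i ]≔ true)
  weaken = groupValue-sound M p _ ∘ groupValue-[]≔true M p g i ∘ groupValue-complete M p g
sound (weak-insert m n as F bs S) M (t ∷ []) =
  GroupTrue-map⁺ M (as ++ bs) (as ++ F ∷ bs) (insertAt m false)
    (λ g → subst T (sym (groupValue-insertAt M as F bs g))) t
sound (dup-down k p S₁ S₂ g) M (t ∷ []) =
  mapSuffix S₁ (λ { (tg ∷ t′) → tg ∷ tg ∷ t′ }) t
sound (dup-up k p S₁ S₂ g) M (t ∷ []) =
  mapSuffix S₁ (λ { (tg ∷ _ ∷ t′) → tg ∷ t′ }) t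
sound (contr m n as F bs S) M (t ∷ []) =
  GroupTrue-map⁺ M (as ++ F ∷ F ∷ bs) (as ++ F ∷ bs) (combineAt m _∨_)
    (λ g → groupValue-combineAt M as bs F F F g
             (merges-contraction (hasFst m g) (hasSnd m g) (eval M F))) t
sound (or-intro m n as F G bs S) M (t ∷ []) =
  GroupTrue-map⁺ M (as ++ F ∷ G ∷ bs) (as ++ (F ∨ᶠ G) ∷ bs) (combineAt m _∨_)
    (λ g → groupValue-combineAt M as bs F G (F ∨ᶠ G) g
             (merges-∨ (hasFst m g) (hasSnd m g) (eval M F) (eval M G))) t
sound (and-intro m n as F G bs S exclusive followed preceded) M (t ∷ []) =
  All.map⁺ (All.map (λ {g} → groupValue-sound M conclusion (combineAt m _∨_ g))
    (groupValue-andMerge M as F G bs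
      (paired _ _ (T? ∘ hasFst m) S exclusive followed preceded)
      (All.map (λ {g} → groupValue-complete M premise g) t)))
  where
  premise : Vec Formula (m + suc (suc n))
  premise = as ++ F ∷ G ∷ bs
  conclusion : Vec Formula (m + suc n)
  conclusion = as ++ (F ∧ᶠ G) ∷ bs

lemma6p1 : ((ps : List Cirquent) (C : Cirquent) → Rule ps C →
    (M : Model) → All (CTrue M) ps → CTrue M C)
    × ((C : Cirquent) → Rule [] C → Tautology C)
lemma6p1 = (λ _ _ rule → sound rule) , (λ _ rule M → sound rule M [])
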